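{- Let $M$ and $N$ be matroids on disjoint finite sets $S$ and $T$, let $A\subseteq S$, $B\subseteq T$, and let $P$ be the principal sum $(M,N;A,B)$. For any sets $X\subseteq S$ and $Y\subseteq T$, the rank $r_P(X\cup Y)$ is the minimum of \[ r_M(X\cup A)+r_N(Y)\qquad\text{and}\qquad r_M(X)+r_N(Y-B)+|Y\cap B|.\]
   Context: For matroids $G$, $H$ on the same set $E$, the matroid union $G\vee H$ is the matroid on $E$ whose independent sets are the sets $I_G\cup I_H$ with $I_G$ independent in $G$, $I_H$ independent in $H$. Let $N_0=N\oplus U_{0,S}$ ($N$ with the elements of $S$ added as loops). For a matroid $K$ on $E$, $A\subseteq E$ and $b\notin E$, the principal extension $K+_Ab$ is the matroid on $E\cup b$ with rank $r(X)=r_K(X)$ and $r(X\cup b)=r_K(X)$ if $A\subseteq \mathrm{cl}_K(X)$, $r(X\cup b)=r_K(X)+1$ otherwise, for $X\subseteq E$. With $B=\{b_1,\dots,b_k\}$, let $M^+(A,B)=(((M+_Ab_1)+_Ab_2)\cdots+_Ab_k)\oplus U_{0,T-B}$; its rank function is $r(X\cup Y)=\min\{r_M(X\cup A),\,r_M(X)+|Y\cap B|\}$ for $X\subseteq S$, $Y\subseteq T$. The principal sum is $(M,N;A,B)=M^+(A,B)\vee N_0$. -}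

module Defs where

open import Data.Nat using (ℕ; _+_; _≤_; _⊓_)
open import Data.Fin.Subset using (Subset; _⊆_; _∪_; _∩_; _─_; ∣_∣; ⊥)
open import Data.Product using (Σ; _×_; _,_; ∃; ∃-syntax; proj₁; proj₂)
open import Relation.Binary.PropositionalEquality using (_≡_)

record Matroid (n : ℕ) : Set where
  field
    r        : Subset n → ℕ
    r-bound  : ∀ X → r X ≤ ∣ X ∣
    r-mono   : ∀ {X Y} → X ⊆ Y → r X ≤ r Y
    r-submod : ∀ X Y → r (X ∪ Y) + r (X ∩ Y) ≤ r X + r Y

open Matroid public

-- Subsets of the disjoint union S ⊔ T, with S = Fin s and T = Fin t:
-- a subset Z = X ∪ Y is represented by the pair (X , Y), X ⊆ S, Y ⊆ T.
SubsetST : ℕ → ℕ → Set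
SubsetST s t = Subset s × Subset t

_⊆ST_ : ∀ {s t} → SubsetST s t → SubsetST s t → Set
(X , Y) ⊆ST (X′ , Y′) = (X ⊆ X′) × (Y ⊆ Y′)

∣_∣ST : ∀ {s t} → SubsetST s t → ℕ
∣ (X , Y) ∣ST = ∣ X ∣ + ∣ Y ∣

-- Rank function of M⁺(A,B) on S ⊔ T (formula from the context):
-- r(X ∪ Y) = min { r_M(X ∪ A) , r_M(X) + |Y ∩ B| }.
rankPlus : ∀ {s t} → Matroid s → Subset s → Subset t → SubsetST s t → ℕ
rankPlus M A B (X , Y) = r M (X ∪ A) ⊓ (r M X + ∣ Y ∩ B ∣)

IndepPlus : ∀ {s t} → Matroid s → Subset s → Subset t → SubsetST s t → Set
IndepPlus M A B Z = rankPlus M A B Z ≡ ∣ Z ∣ST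

-- N₀ = N ⊕ U_{0,S}: rank r_{N₀}(X ∪ Y) = r_N(Y); independent iff rank = cardinality.
rankN₀ : ∀ {s t} → Matroid t → SubsetST s t → ℕ
rankN₀ N (X , Y) = r N Y

IndepN₀ : ∀ {s t} → Matroid t → SubsetST s t → Set
IndepN₀ N Z = rankN₀ N Z ≡ ∣ Z ∣ST

-- Independent sets of the principal sum P = (M,N;A,B) = M⁺(A,B) ∨ N₀:
-- unions I_G ∪ I_H of an M⁺(A,B)-independent and an N₀-independent set.
IndepP : ∀ {s t} → Matroid s → Matroid t → Subset s → Subset t → SubsetST s t → Set
IndepP M N A B (X , Y) =
  ∃[ I ] ∃[ J ] (IndepPlus M A B I × IndepN₀ N J
     × (X ≡ proj₁ I ∪ proj₁ J) × (Y ≡ proj₂ I ∪ proj₂ J))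

RankP : ∀ {s t} → Matroid s → Matroid t → Subset s → Subset t → SubsetST s t → ℕ → Set
RankP M N A B Z k =
  (∃[ I ] (I ⊆ST Z × IndepP M N A B I × ∣ I ∣ST ≡ k))
  × (∀ J → J ⊆ST Z → IndepP M N A B J → ∣ J ∣ST ≤ k)

module Submission where

-- Rank of a principal sum P = (M,N;A,B) = M⁺(A,B) ∨ N₀ on X ∪ Y, X ⊆ S, Y ⊆ T.
-- Write  a = r_M(X ∪ A) + r_N(Y)  and  b = r_M(X) + r_N(Y − B) + |Y ∩ B|.
--
-- A P-independent set is I ∪ J with I independent in M⁺(A,B)
-- and J = (J_S , J_T) independent in N₀. Then |I ∪ J| ≤ |I| + |J|
-- ≤ r_M(I_S ∪ A) + r_N(J_T) ≤ a. Splitting the T-parts along B, the rank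
-- formula of M⁺ gives |I_S| + |I_T − B| ≤ r_M(X), subadditivity of r_N gives
-- |J_S| + |J_T − B| ≤ r_N(Y − B), and the parts inside B contribute at most
-- |Y ∩ B|; hence |I ∪ J| ≤ b.
--
-- Take a basis I_X of X in M and a basis J_B of Y − B in N, and
-- extend J_B to a basis J of Y. With D₀ = (Y ∩ B) − J one gets
-- b ≤ r_M(X) + r_N(Y) + |D₀|. For D ⊆ D₀ of size e = (r_M(X ∪ A) − r_M(X)) ⊓ |D₀|
-- the set (I_X , D) is M⁺-independent and (∅ , J) is N₀-independent, and their
-- union has size r_M(X) + r_N(Y) + e ≥ a ⊓ b.

open import Defs
open import Data.Nat using (ℕ; zero; suc; _+_; _⊓_; _∸_; _≤_; _≟_; s≤s)
open import Data.Nat.Properties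
open import Data.Nat.Tactic.RingSolver using (solve-∀)
open import Data.Fin using (Fin)
open import Data.Fin.Subset
open import Data.Fin.Subset.Properties
open import Data.Vec using ([]; _∷_; here; there)
open import Data.List using (List; []; _∷_; allFin)
open import Data.List.Relation.Unary.Any using () renaming (here to hereₗ; there to thereₗ)
open import Data.List.Membership.Propositional using () renaming (_∈_ to _∈ₗ_)
open import Data.List.Membership.Propositional.Properties using (∈-allFin)
open import Data.Product using (_,_; _×_; ∃-syntax; proj₁; proj₂)
open import Data.Sum using ([_,_]′)
open import Relation.Nullary using (yes; no; contradiction)
open import Relation.Binary.PropositionalEquality

private variable n : ℕ

∪-least : {p q u : Subset n} → p ⊆ u → q ⊆ u → p ∪ q ⊆ u
∪-least {p = p} {q} p⊆u q⊆u x∈ = [ p⊆u , q⊆u ]′ (x∈p∪q⁻ p q x∈)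

∩-greatest : {p q u : Subset n} → u ⊆ p → u ⊆ q → u ⊆ p ∩ q
∩-greatest u⊆p u⊆q x∈ = x∈p∩q⁺ (u⊆p x∈ , u⊆q x∈)

x∈p─q⇒x∉q : ∀ {x : Fin n} (p q : Subset n) → x ∈ p ─ q → x ∉ q
x∈p─q⇒x∉q (_ ∷ p) (outside ∷ q) here       ()
x∈p─q⇒x∉q (_ ∷ p) (_       ∷ q) (there x∈) (there x∈q) = x∈p─q⇒x∉q p q x∈ x∈q

∩-monoˡ : {p q : Subset n} (u : Subset n) → p ⊆ q → p ∩ u ⊆ q ∩ u
∩-monoˡ {p = p} u p⊆q x∈ = let x∈p , x∈u = x∈p∩q⁻ p u x∈ in x∈p∩q⁺ (p⊆q x∈p , x∈u)

─-monoˡ : {p q : Subset n} (u : Subset n) → p ⊆ q → p ─ u ⊆ q ─ u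
─-monoˡ {p = p} u p⊆q x∈ = x∈p∧x∉q⇒x∈p─q (p⊆q (p─q⊆p p u x∈)) (x∈p─q⇒x∉q p u x∈)

∪─⊆ : (p q u : Subset n) → (p ∪ q) ─ u ⊆ (p ─ u) ∪ (q ─ u)
∪─⊆ p q u x∈ = [ (λ x∈p → p⊆p∪q _ (x∈p∧x∉q⇒x∈p─q x∈p x∉u))
               , (λ x∈q → q⊆p∪q _ _ (x∈p∧x∉q⇒x∈p─q x∈q x∉u)) ]′
               (x∈p∪q⁻ p q (p─q⊆p (p ∪ q) u x∈))
  where x∉u = x∈p─q⇒x∉q (p ∪ q) u x∈

∣p∪q∣+∣p∩q∣ : (p q : Subset n) → ∣ p ∪ q ∣ + ∣ p ∩ q ∣ ≡ ∣ p ∣ + ∣ q ∣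
∣p∪q∣+∣p∩q∣ []            []            = refl
∣p∪q∣+∣p∩q∣ (inside ∷ p)  (inside ∷ q)  =
  cong suc (trans (+-suc _ _) (trans (cong suc (∣p∪q∣+∣p∩q∣ p q)) (sym (+-suc _ _))))
∣p∪q∣+∣p∩q∣ (inside ∷ p)  (outside ∷ q) = cong suc (∣p∪q∣+∣p∩q∣ p q)
∣p∪q∣+∣p∩q∣ (outside ∷ p) (inside ∷ q)  = trans (cong suc (∣p∪q∣+∣p∩q∣ p q)) (sym (+-suc _ _))
∣p∪q∣+∣p∩q∣ (outside ∷ p) (outside ∷ q) = ∣p∪q∣+∣p∩q∣ p q

∣p∣≡∣p∩q∣+∣p─q∣ : (p q : Subset n) → ∣ p ∣ ≡ ∣ p ∩ q ∣ + ∣ p ─ q ∣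
∣p∣≡∣p∩q∣+∣p─q∣ []            []            = refl
∣p∣≡∣p∩q∣+∣p─q∣ (inside ∷ p)  (inside ∷ q)  = cong suc (∣p∣≡∣p∩q∣+∣p─q∣ p q)
∣p∣≡∣p∩q∣+∣p─q∣ (inside ∷ p)  (outside ∷ q) = trans (cong suc (∣p∣≡∣p∩q∣+∣p─q∣ p q)) (sym (+-suc _ _))
∣p∣≡∣p∩q∣+∣p─q∣ (outside ∷ p) (inside ∷ q)  = ∣p∣≡∣p∩q∣+∣p─q∣ p q
∣p∣≡∣p∩q∣+∣p─q∣ (outside ∷ p) (outside ∷ q) = ∣p∣≡∣p∩q∣+∣p─q∣ p q

∣p∪q∣≤∣p∣+∣q∣ : (p q : Subset n) → ∣ p ∪ q ∣ ≤ ∣ p ∣ + ∣ q ∣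
∣p∪q∣≤∣p∣+∣q∣ p q = subst (∣ p ∪ q ∣ ≤_) (∣p∪q∣+∣p∩q∣ p q) (m≤m+n _ _)

∣disjoint-∪∣ : (p q : Subset n) → (∀ {x} → x ∈ p → x ∉ q) → ∣ p ∪ q ∣ ≡ ∣ p ∣ + ∣ q ∣
∣disjoint-∪∣ {n} p q disjoint = begin
  ∣ p ∪ q ∣               ≡⟨ +-identityʳ _ ⟨
  ∣ p ∪ q ∣ + 0           ≡⟨ cong (∣ p ∪ q ∣ +_) ∣p∩q∣≡0 ⟨
  ∣ p ∪ q ∣ + ∣ p ∩ q ∣   ≡⟨ ∣p∪q∣+∣p∩q∣ p q ⟩
  ∣ p ∣ + ∣ q ∣           ∎
  where
  open ≡-Reasoning
  ∣p∩q∣≡0 : ∣ p ∩ q ∣ ≡ 0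
  ∣p∩q∣≡0 = trans (cong ∣_∣ p∩q≡⊥) (∣⊥∣≡0 n)
    where
    p∩q≡⊥ : p ∩ q ≡ ⊥
    p∩q≡⊥ = ⊆-antisym (λ x∈ → let x∈p , x∈q = x∈p∩q⁻ p q x∈ in contradiction x∈q (disjoint x∈p)) ⊥⊆

subset-of-size : (e : ℕ) (p : Subset n) → e ≤ ∣ p ∣ → ∃[ q ] (q ⊆ p × ∣ q ∣ ≡ e)
subset-of-size {n} zero p _ = ⊥ , ⊥⊆ , ∣⊥∣≡0 n
subset-of-size (suc e) (inside ∷ p) (s≤s e≤∣p∣) with subset-of-size e p e≤∣p∣
... | q , q⊆p , ∣q∣≡e = inside ∷ q , s⊆s q⊆p , cong suc ∣q∣≡e
subset-of-size (suc e) (outside ∷ p) e≤∣p∣ with subset-of-size (suc e) p e≤∣p∣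
... | q , q⊆p , ∣q∣≡e = outside ∷ q , s⊆s q⊆p , ∣q∣≡e

drop-common-part : ∀ k c (p q : Subset n) → k + ∣ p ∣ ≤ c + ∣ p ∩ q ∣ → k + ∣ p ─ q ∣ ≤ c
drop-common-part k c p q le = +-cancelʳ-≤ ∣ p ∩ q ∣ _ _ (begin
  k + ∣ p ─ q ∣ + ∣ p ∩ q ∣     ≡⟨ rearrange k (∣ p ─ q ∣) (∣ p ∩ q ∣) ⟩
  k + (∣ p ∩ q ∣ + ∣ p ─ q ∣)   ≡⟨ cong (k +_) (∣p∣≡∣p∩q∣+∣p─q∣ p q) ⟨
  k + ∣ p ∣                     ≤⟨ le ⟩
  c + ∣ p ∩ q ∣                 ∎)
  where
  open ≤-Reasoning
  rearrange : ∀ x y z → x + y + z ≡ x + (z + y)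
  rearrange = solve-∀

_↾_ : Subset n → List (Fin n) → Subset n
z ↾ []      = ⊥
z ↾ (x ∷ L) = (z ↾ L) ∪ (z ∩ ⁅ x ⁆)

↾-allFin : (z : Subset n) → z ↾ allFin n ≡ z
↾-allFin {n} z = ⊆-antisym (↾⊆ (allFin n)) (λ x∈ → ⊆↾ (allFin n) (∈-allFin _) x∈)
  where
  ↾⊆ : ∀ L → z ↾ L ⊆ z
  ↾⊆ []      x∈ = contradiction x∈ ∉⊥
  ↾⊆ (x ∷ L) = ∪-least (↾⊆ L) (p∩q⊆p z ⁅ x ⁆)
  ⊆↾ : ∀ L {x} → x ∈ₗ L → x ∈ z → x ∈ z ↾ L
  ⊆↾ (y ∷ L) (hereₗ refl) x∈ = q⊆p∪q _ _ (x∈p∩q⁺ (x∈ , x∈⁅x⁆ y))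
  ⊆↾ (y ∷ L) (thereₗ x∈L) x∈ = p⊆p∪q _ (⊆↾ L x∈L x∈)

module RankFacts {n : ℕ} (M : Matroid n) where
  open ≤-Reasoning

  r-⊥ : r M ⊥ ≡ 0
  r-⊥ = n≤0⇒n≡0 (subst (r M ⊥ ≤_) (∣⊥∣≡0 n) (r-bound M ⊥))

  r-subadditive : ∀ p q → r M (p ∪ q) ≤ r M p + r M q
  r-subadditive p q = ≤-trans (m≤m+n _ _) (r-submod M p q)

  r-split : ∀ p q → r M p ≤ ∣ p ∩ q ∣ + r M (p ─ q)
  r-split p q = begin
    r M p                              ≤⟨ r-mono M split ⟩
    r M ((p ∩ q) ∪ (p ─ q))            ≤⟨ r-subadditive (p ∩ q) (p ─ q) ⟩
    r M (p ∩ q) + r M (p ─ q)          ≤⟨ +-monoˡ-≤ _ (r-bound M (p ∩ q)) ⟩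
    ∣ p ∩ q ∣ + r M (p ─ q)            ∎
    where
    split : p ⊆ (p ∩ q) ∪ (p ─ q)
    split {x} x∈p with x ∈? q
    ... | yes x∈q = p⊆p∪q _ (x∈p∩q⁺ (x∈p , x∈q))
    ... | no  x∉q = q⊆p∪q _ _ (x∈p∧x∉q⇒x∈p─q x∈p x∉q)

  -- If I ⊆ X has full rank in X, then I ∪ A has full rank in X ∪ A
  -- (submodularity applied to X and I ∪ A, whose intersection contains I).
  r-closure : ∀ {I X} A → I ⊆ X → r M X ≤ r M I → r M (X ∪ A) ≤ r M (I ∪ A)
  r-closure {I} {X} A I⊆X rX≤rI = +-cancelʳ-≤ (r M I) _ _ (begin
    r M (X ∪ A) + r M I                ≤⟨ +-mono-≤ (r-mono M X∪A⊆) (r-mono M I⊆) ⟩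
    r M (X ∪ (I ∪ A)) + r M (X ∩ (I ∪ A)) ≤⟨ r-submod M X (I ∪ A) ⟩
    r M X + r M (I ∪ A)                ≤⟨ +-monoˡ-≤ _ rX≤rI ⟩
    r M I + r M (I ∪ A)                ≡⟨ +-comm (r M I) _ ⟩
    r M (I ∪ A) + r M I                ∎)
    where
    X∪A⊆ : X ∪ A ⊆ X ∪ (I ∪ A)
    X∪A⊆ = ∪-least (p⊆p∪q _) (λ x∈ → q⊆p∪q X _ (q⊆p∪q I A x∈))
    I⊆ : I ⊆ X ∩ (I ∪ A)
    I⊆ = ∩-greatest I⊆X (p⊆p∪q A)

  record IsBasis (W I : Subset n) : Set where
    field
      basis⊆      : I ⊆ W
      independent : r M I ≡ ∣ I ∣
      spanning    : r M W ≤ r M I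
  open IsBasis public

  basis-size : ∀ {W I} → IsBasis W I → ∣ I ∣ ≡ r M W
  basis-size {W} {I} b =
    ≤-antisym (subst (_≤ r M W) (independent b) (r-mono M (basis⊆ b)))
              (subst (r M W ≤_) (independent b) (spanning b))

  basis-restrict : ∀ {W W′ I} → IsBasis W I → I ⊆ W′ → W′ ⊆ W → IsBasis W′ I
  basis-restrict b I⊆W′ W′⊆W = record
    { basis⊆ = I⊆W′ ; independent = independent b
    ; spanning = ≤-trans (r-mono M W′⊆W) (spanning b) }

  -- Augmentation step: a basis of W extends to a basis of W ∪ E when E has at
  -- most one element (either I ∪ E is independent, or E adds no rank to I).
  augment : ∀ {W I} → IsBasis W I → ∀ E → ∣ E ∣ ≤ 1 → ∃[ I′ ] (I ⊆ I′ × IsBasis (W ∪ E) I′)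
  augment {W} {I} b E ∣E∣≤1 with r M (I ∪ E) ≟ ∣ I ∪ E ∣
  ... | yes indep = I ∪ E , p⊆p∪q E , record
    { basis⊆ = ∪-least (λ x∈ → p⊆p∪q E (basis⊆ b x∈)) (q⊆p∪q W E)
    ; independent = indep
    ; spanning = r-closure E (basis⊆ b) (spanning b) }
  ... | no dep = I , ⊆-refl , record
    { basis⊆ = λ x∈ → p⊆p∪q E (basis⊆ b x∈)
    ; independent = independent b
    ; spanning = ≤-trans (r-closure E (basis⊆ b) (spanning b)) rI∪E≤rI }
    where
    rI∪E≤rI : r M (I ∪ E) ≤ r M I
    rI∪E≤rI = ≤-pred (begin-strict
      r M (I ∪ E)   <⟨ ≤∧≢⇒< (r-bound M (I ∪ E)) dep ⟩
      ∣ I ∪ E ∣     ≤⟨ ∣p∪q∣≤∣p∣+∣q∣ I E ⟩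
      ∣ I ∣ + ∣ E ∣ ≤⟨ +-monoʳ-≤ ∣ I ∣ ∣E∣≤1 ⟩
      ∣ I ∣ + 1     ≡⟨ +-comm ∣ I ∣ 1 ⟩
      suc ∣ I ∣     ≡⟨ cong suc (independent b) ⟨
      suc (r M I)   ∎)

  -- Extension: a basis of W extends to a basis of W ∪ z, by applying the
  -- augmentation step to the elements of z one at a time.
  extend : ∀ {W I} → IsBasis W I → ∀ z → ∃[ I′ ] (I ⊆ I′ × IsBasis (W ∪ z) I′)
  extend {W} {I} b z = subst (λ V → ∃[ I′ ] (I ⊆ I′ × IsBasis (W ∪ V) I′)) (↾-allFin z) (along (allFin n))
    where
    along : ∀ L → ∃[ I′ ] (I ⊆ I′ × IsBasis (W ∪ (z ↾ L)) I′)
    along []      = I , ⊆-refl , subst (λ V → IsBasis V I) (sym (∪-identityʳ W)) b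
    along (x ∷ L) with along L
    ... | I′ , I⊆I′ , b′ with augment b′ (z ∩ ⁅ x ⁆) (subst (∣ z ∩ ⁅ x ⁆ ∣ ≤_) (∣⁅x⁆∣≡1 x) (∣p∩q∣≤∣q∣ z ⁅ x ⁆))
    ... | I″ , I′⊆I″ , b″ = I″ , ⊆-trans I⊆I′ I′⊆I″ , subst (λ V → IsBasis V I″) (∪-assoc W (z ↾ L) (z ∩ ⁅ x ⁆)) b″

  basis-exists : ∀ W → ∃[ I ] IsBasis W I
  basis-exists W = let I , _ , b = extend empty W in I , subst (λ V → IsBasis V I) (∪-identityˡ W) b
    where
    empty : IsBasis ⊥ ⊥
    empty = record { basis⊆ = ⊆-refl ; independent = trans r-⊥ (sym (∣⊥∣≡0 n)) ; spanning = ≤-refl }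

module PrincipalSum {s t} (M : Matroid s) (N : Matroid t) (A : Subset s) (B : Subset t) where
  open RankFacts using (IsBasis; basis⊆; independent; spanning)
  module RM = RankFacts M
  module RN = RankFacts N
  open ≤-Reasoning

  bound-a bound-b : Subset s → Subset t → ℕ
  bound-a X Y = r M (X ∪ A) + r N Y
  bound-b X Y = r M X + r N (Y ─ B) + ∣ Y ∩ B ∣

  plus-outside-B : ∀ {Is It} → IndepPlus M A B (Is , It) → ∣ Is ∣ + ∣ It ─ B ∣ ≤ r M Is
  plus-outside-B {Is} {It} indep = drop-common-part ∣ Is ∣ (r M Is) It B (begin
    ∣ Is ∣ + ∣ It ∣            ≡⟨ indep ⟨
    rankPlus M A B (Is , It)   ≤⟨ m⊓n≤n _ _ ⟩
    r M Is + ∣ It ∩ B ∣        ∎)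

  N₀-outside-B : ∀ {Js : Subset s} {Jt} → IndepN₀ N (Js , Jt) → ∣ Js ∣ + ∣ Jt ─ B ∣ ≤ r N (Jt ─ B)
  N₀-outside-B {Js} {Jt} indep = drop-common-part ∣ Js ∣ (r N (Jt ─ B)) Jt B (begin
    ∣ Js ∣ + ∣ Jt ∣            ≡⟨ indep ⟨
    r N Jt                     ≤⟨ RN.r-split Jt B ⟩
    ∣ Jt ∩ B ∣ + r N (Jt ─ B)  ≡⟨ +-comm ∣ Jt ∩ B ∣ _ ⟩
    r N (Jt ─ B) + ∣ Jt ∩ B ∣  ∎)

  upper-bound : ∀ X Y J → J ⊆ST (X , Y) → IndepP M N A B J → ∣ J ∣ST ≤ bound-a X Y ⊓ bound-b X Y
  upper-bound X Y _ (Is∪Js⊆X , It∪Jt⊆Y) ((Is , It) , (Js , Jt) , indI , indJ , refl , refl) =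
    ⊓-glb ≤a ≤b
    where
    Is⊆X : Is ⊆ X
    Is⊆X x∈ = Is∪Js⊆X (p⊆p∪q Js x∈)
    Jt⊆Y : Jt ⊆ Y
    Jt⊆Y x∈ = It∪Jt⊆Y (q⊆p∪q It Jt x∈)
    swap-middle : ∀ w x y z → (w + x) + (y + z) ≡ (w + y) + (x + z)
    swap-middle = solve-∀
    regroup : ∀ w x c y z → (w + x) + (c + (y + z)) ≡ (w + y) + (x + z) + c
    regroup = solve-∀

    ≤a : ∣ Is ∪ Js ∣ + ∣ It ∪ Jt ∣ ≤ bound-a X Y
    ≤a = begin
      ∣ Is ∪ Js ∣ + ∣ It ∪ Jt ∣              ≤⟨ +-mono-≤ (∣p∪q∣≤∣p∣+∣q∣ Is Js) (∣p∪q∣≤∣p∣+∣q∣ It Jt) ⟩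
      (∣ Is ∣ + ∣ Js ∣) + (∣ It ∣ + ∣ Jt ∣)  ≡⟨ swap-middle (∣ Is ∣) (∣ Js ∣) (∣ It ∣) (∣ Jt ∣) ⟩
      (∣ Is ∣ + ∣ It ∣) + (∣ Js ∣ + ∣ Jt ∣)  ≡⟨ cong₂ _+_ indI indJ ⟨
      rankPlus M A B (Is , It) + r N Jt      ≤⟨ +-monoˡ-≤ (r N Jt) (m⊓n≤m (r M (Is ∪ A)) _) ⟩
      r M (Is ∪ A) + r N Jt                  ≤⟨ +-mono-≤ (r-mono M Is∪A⊆X∪A) (r-mono N Jt⊆Y) ⟩
      bound-a X Y                            ∎
      where
      Is∪A⊆X∪A : Is ∪ A ⊆ X ∪ A
      Is∪A⊆X∪A = ∪-least (λ x∈ → p⊆p∪q A (Is⊆X x∈)) (q⊆p∪q X A)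

    ≤b : ∣ Is ∪ Js ∣ + ∣ It ∪ Jt ∣ ≤ bound-b X Y
    ≤b = begin
      ∣ Is ∪ Js ∣ + ∣ It ∪ Jt ∣
        ≡⟨ cong (∣ Is ∪ Js ∣ +_) (∣p∣≡∣p∩q∣+∣p─q∣ (It ∪ Jt) B) ⟩
      ∣ Is ∪ Js ∣ + (∣ (It ∪ Jt) ∩ B ∣ + ∣ (It ∪ Jt) ─ B ∣)
        ≤⟨ +-mono-≤ (∣p∪q∣≤∣p∣+∣q∣ Is Js) (+-mono-≤ inside-B outside-B) ⟩
      (∣ Is ∣ + ∣ Js ∣) + (∣ Y ∩ B ∣ + (∣ It ─ B ∣ + ∣ Jt ─ B ∣))
        ≡⟨ regroup (∣ Is ∣) (∣ Js ∣) (∣ Y ∩ B ∣) (∣ It ─ B ∣) (∣ Jt ─ B ∣) ⟩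
      (∣ Is ∣ + ∣ It ─ B ∣) + (∣ Js ∣ + ∣ Jt ─ B ∣) + ∣ Y ∩ B ∣
        ≤⟨ +-monoˡ-≤ _ (+-mono-≤ (≤-trans (plus-outside-B {Is} {It} indI) (r-mono M Is⊆X))
                                 (≤-trans (N₀-outside-B {Js} {Jt} indJ) (r-mono N (─-monoˡ B Jt⊆Y)))) ⟩
      bound-b X Y
        ∎
      where
      inside-B : ∣ (It ∪ Jt) ∩ B ∣ ≤ ∣ Y ∩ B ∣
      inside-B = p⊆q⇒∣p∣≤∣q∣ (∩-monoˡ B It∪Jt⊆Y)
      outside-B : ∣ (It ∪ Jt) ─ B ∣ ≤ ∣ It ─ B ∣ + ∣ Jt ─ B ∣
      outside-B = ≤-trans (p⊆q⇒∣p∣≤∣q∣ (∪─⊆ It Jt B)) (∣p∪q∣≤∣p∣+∣q∣ (It ─ B) (Jt ─ B))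

  missing-from-basis : ∀ {Y Jb J} → IsBasis N (Y ─ B) Jb → Jb ⊆ J → IsBasis N Y J →
    r N (Y ─ B) + ∣ Y ∩ B ∣ ≤ r N Y + ∣ (Y ∩ B) ─ J ∣
  missing-from-basis {Y} {Jb} {J} bB Jb⊆J bY = begin
    r N (Y ─ B) + ∣ Y ∩ B ∣        ≡⟨ cong₂ _+_ (sym (RN.basis-size bB)) (∣p∣≡∣p∩q∣+∣p─q∣ (Y ∩ B) J) ⟩
    ∣ Jb ∣ + (∣ P ∣ + ∣ D₀ ∣)      ≡⟨ +-assoc ∣ Jb ∣ _ _ ⟨
    ∣ Jb ∣ + ∣ P ∣ + ∣ D₀ ∣        ≡⟨ cong (_+ ∣ D₀ ∣) (∣disjoint-∪∣ Jb P Jb∉P) ⟨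
    ∣ Jb ∪ P ∣ + ∣ D₀ ∣            ≤⟨ +-monoˡ-≤ _ (p⊆q⇒∣p∣≤∣q∣ (∪-least Jb⊆J (p∩q⊆q (Y ∩ B) J))) ⟩
    ∣ J ∣ + ∣ D₀ ∣                 ≡⟨ cong (_+ ∣ D₀ ∣) (RN.basis-size bY) ⟩
    r N Y + ∣ D₀ ∣                 ∎
    where
    P = (Y ∩ B) ∩ J
    D₀ = (Y ∩ B) ─ J
    Jb∉P : ∀ {x} → x ∈ Jb → x ∉ P
    Jb∉P x∈Jb x∈P = x∈p─q⇒x∉q Y B (basis⊆ bB x∈Jb) (p∩q⊆q Y B (p∩q⊆p (Y ∩ B) J x∈P))

  plus-independent : ∀ {X Is D} → IsBasis M X Is → D ⊆ B → r M X + ∣ D ∣ ≤ r M (X ∪ A) →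
    IndepPlus M A B (Is , D)
  plus-independent {X} {Is} {D} bX D⊆B fits =
    trans (cong₂ (λ u v → r M (Is ∪ A) ⊓ (u + v)) (independent bX) (cong ∣_∣ D∩B≡D))
          (m≥n⇒m⊓n≡n ∣Is∣+∣D∣≤rIs∪A)
    where
    D∩B≡D : D ∩ B ≡ D
    D∩B≡D = ⊆-antisym (p∩q⊆p D B) (∩-greatest ⊆-refl D⊆B)
    ∣Is∣+∣D∣≤rIs∪A : ∣ Is ∣ + ∣ D ∣ ≤ r M (Is ∪ A)
    ∣Is∣+∣D∣≤rIs∪A = begin
      ∣ Is ∣ + ∣ D ∣   ≡⟨ cong (_+ ∣ D ∣) (RM.basis-size bX) ⟩
      r M X + ∣ D ∣    ≤⟨ fits ⟩
      r M (X ∪ A)      ≤⟨ RM.r-closure A (basis⊆ bX) (spanning bX) ⟩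
      r M (Is ∪ A)     ∎

  r+gain : ∀ X → r M X + (r M (X ∪ A) ∸ r M X) ≡ r M (X ∪ A)
  r+gain X = m+[n∸m]≡n (r-mono M (p⊆p∪q A))

  bounds≤base+excess : ∀ {X Y Jb J} → IsBasis N (Y ─ B) Jb → Jb ⊆ J → IsBasis N Y J →
    bound-a X Y ⊓ bound-b X Y ≤ r M X + r N Y + ((r M (X ∪ A) ∸ r M X) ⊓ ∣ (Y ∩ B) ─ J ∣)
  bounds≤base+excess {X} {Y} {Jb} {J} bB Jb⊆J bY = begin
    bound-a X Y ⊓ bound-b X Y        ≤⟨ ⊓-mono-≤ (≤-reflexive a≡base+gain) b≤base+∣D₀∣ ⟩
    (base + gain) ⊓ (base + ∣ D₀ ∣)  ≡⟨ +-distribˡ-⊓ base gain (∣ D₀ ∣) ⟨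
    base + gain ⊓ ∣ D₀ ∣             ∎
    where
    D₀ = (Y ∩ B) ─ J
    gain = r M (X ∪ A) ∸ r M X
    base = r M X + r N Y

    a≡base+gain : bound-a X Y ≡ base + gain
    a≡base+gain = trans (cong (_+ r N Y) (sym (r+gain X))) (swap-last (r M X) gain (r N Y))
      where
      swap-last : ∀ x y z → x + y + z ≡ x + z + y
      swap-last = solve-∀

    b≤base+∣D₀∣ : bound-b X Y ≤ base + ∣ D₀ ∣
    b≤base+∣D₀∣ = begin
      r M X + r N (Y ─ B) + ∣ Y ∩ B ∣    ≡⟨ +-assoc (r M X) _ _ ⟩
      r M X + (r N (Y ─ B) + ∣ Y ∩ B ∣)  ≤⟨ +-monoʳ-≤ (r M X) (missing-from-basis bB Jb⊆J bY) ⟩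
      r M X + (r N Y + ∣ D₀ ∣)           ≡⟨ +-assoc (r M X) _ _ ⟨
      base + ∣ D₀ ∣                      ∎

  -- It is the union of
  -- (Is , D), independent in M⁺(A,B), and (∅ , J), independent in N₀, where
  -- D ⊆ (Y ∩ B) ─ J has as many elements as A adds to the rank of X, if possible.
  large-independent-set : ∀ {X Y Is Jb J} →
    IsBasis M X Is → IsBasis N (Y ─ B) Jb → Jb ⊆ J → IsBasis N Y J →
    ∃[ I ] (I ⊆ST (X , Y) × IndepP M N A B I × bound-a X Y ⊓ bound-b X Y ≤ ∣ I ∣ST)
  large-independent-set {X} {Y} {Is} {Jb} {J} bX bB Jb⊆J bY =
    (Is ∪ ⊥ , D ∪ J) , (∪-least (basis⊆ bX) ⊥⊆ , ∪-least D⊆Y (basis⊆ bY))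
    , ((Is , D) , (⊥ , J) , plus-independent bX D⊆B D-fits , N₀-independent , refl , refl)
    , large
    where
    D₀ = (Y ∩ B) ─ J
    gain = r M (X ∪ A) ∸ r M X
    e = gain ⊓ ∣ D₀ ∣

    chosen : ∃[ D ] (D ⊆ D₀ × ∣ D ∣ ≡ e)
    chosen = subset-of-size e D₀ (m⊓n≤n gain (∣ D₀ ∣))
    D = proj₁ chosen
    D⊆D₀ : D ⊆ D₀
    D⊆D₀ = proj₁ (proj₂ chosen)
    ∣D∣≡e : ∣ D ∣ ≡ e
    ∣D∣≡e = proj₂ (proj₂ chosen)

    D⊆Y : D ⊆ Y
    D⊆Y x∈ = p∩q⊆p Y B (p─q⊆p (Y ∩ B) J (D⊆D₀ x∈))
    D⊆B : D ⊆ B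
    D⊆B x∈ = p∩q⊆q Y B (p─q⊆p (Y ∩ B) J (D⊆D₀ x∈))
    D∉J : ∀ {x} → x ∈ D → x ∉ J
    D∉J x∈ = x∈p─q⇒x∉q (Y ∩ B) J (D⊆D₀ x∈)

    D-fits : r M X + ∣ D ∣ ≤ r M (X ∪ A)
    D-fits = begin
      r M X + ∣ D ∣    ≡⟨ cong (r M X +_) ∣D∣≡e ⟩
      r M X + e        ≤⟨ +-monoʳ-≤ (r M X) (m⊓n≤m gain (∣ D₀ ∣)) ⟩
      r M X + gain     ≡⟨ r+gain X ⟩
      r M (X ∪ A)      ∎

    N₀-independent : r N J ≡ ∣ ⊥ {s} ∣ + ∣ J ∣
    N₀-independent = trans (independent bY) (cong (_+ ∣ J ∣) (sym (∣⊥∣≡0 s)))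

    large : bound-a X Y ⊓ bound-b X Y ≤ ∣ Is ∪ ⊥ ∣ + ∣ D ∪ J ∣
    large = begin
      bound-a X Y ⊓ bound-b X Y        ≤⟨ bounds≤base+excess {X} bB Jb⊆J bY ⟩
      r M X + r N Y + e                ≡⟨ regroup (r M X) (r N Y) e ⟩
      r M X + (e + r N Y)              ≡⟨ cong₂ (λ u v → u + (v + r N Y)) (RM.basis-size bX) ∣D∣≡e ⟨
      ∣ Is ∣ + (∣ D ∣ + r N Y)         ≡⟨ cong (λ u → ∣ Is ∣ + (∣ D ∣ + u)) (RN.basis-size bY) ⟨
      ∣ Is ∣ + (∣ D ∣ + ∣ J ∣)         ≡⟨ cong₂ _+_ (cong ∣_∣ (∪-identityʳ Is)) (∣disjoint-∪∣ D J D∉J) ⟨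
      ∣ Is ∪ ⊥ ∣ + ∣ D ∪ J ∣           ∎
      where
      regroup : ∀ x y z → x + y + z ≡ x + (z + y)
      regroup = solve-∀

theorem3p5 : ∀ {s t} (M : Matroid s) (N : Matroid t) (A : Subset s) (B : Subset t)
    (X : Subset s) (Y : Subset t) →
    RankP M N A B (X , Y)
    ((r M (X ∪ A) + r N Y) ⊓ (r M X + r N (Y ─ B) + ∣ Y ∩ B ∣))
theorem3p5 M N A B X Y =
  let open PrincipalSum M N A B
      open RankFacts using (basis-exists; extend; basis-restrict; basis⊆)
      Is , basisX           = basis-exists M X
      Jb , basisY─B         = basis-exists N (Y ─ B)
      J , Jb⊆J , basis-ext  = extend N basisY─B Y
      J⊆Y                   = ⊆-trans (basis⊆ basis-ext) (∪-least (p─q⊆p Y B) ⊆-refl)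
      basisY                = basis-restrict N basis-ext J⊆Y (q⊆p∪q (Y ─ B) Y)
      I , I⊆X∪Y , I-indep , large = large-independent-set basisX basisY─B Jb⊆J basisY
  in (I , I⊆X∪Y , I-indep , ≤-antisym (upper-bound X Y I I⊆X∪Y I-indep) large) , upper-bound X Y
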